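{- In $W(D_4)$ we have $w_4\sim_{LR}s_1s_2s_4$, where $w_4$ is the signed permutation with one-line notation $(1,-4,3,-2)$.
   Context: $W(D_4)$ is the Coxeter group with generators $s_1,s_2,s_3,s_4$, where $s_1s_3,s_2s_3,s_3s_4$ have order 3 and all other pairs of distinct generators commute, realized as signed permutations of $\{\pm1,\dots,\pm4\}$ with an even number of sign changes via $s_1\mapsto(1,-2)(-1,2)$, $s_i\mapsto(i-1,i)(-(i-1),-i)$ ($i\ge2$), products being compositions of functions; one-line notation is $(w(1),\dots,w(4))$. $\sim_{LR}$ denotes two-sided Kazhdan--Lusztig cell equivalence. -}

module Defs where

open import Data.Bool using (Bool; true; false; if_then_else_; not; _∧_; _∨_)
open import Data.Nat as ℕ using (ℕ; zero; suc; _∸_; _<ᵇ_; _≡ᵇ_)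
open import Data.Integer as ℤ using (ℤ; +_; -[1+_])
open import Data.List using (List; []; _∷_; _++_; concat; concatMap; map; foldr)
open import Data.Vec using (Vec; []; _∷_)
import Data.Vec as Vec
open import Data.Product using (Σ; _×_; _,_; proj₁; proj₂)
open import Relation.Binary.PropositionalEquality using (_≡_; _≢_)
open import Relation.Nullary using (¬_)
open import Relation.Nullary.Decidable using (⌊_⌋)
import Data.Vec.Properties as VecP

-- Signed permutations of {±1,…,±4}, stored by one-line notation
-- (w(1),…,w(4)); w(-i) = -w(i).

SP : Set
SP = Vec ℤ 4

eqZ : ℤ → ℤ → Bool
eqZ (+ m)    (+ n)    = m ≡ᵇ n
eqZ -[1+ m ] -[1+ n ] = m ≡ᵇ n
eqZ _        _        = false

ltZ : ℤ → ℤ → Bool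
ltZ (+ m)    (+ n)    = m <ᵇ n
ltZ (+ m)    -[1+ n ] = false
ltZ -[1+ m ] (+ n)    = true
ltZ -[1+ m ] -[1+ n ] = n <ᵇ m

eqV : ∀ {n} → Vec ℤ n → Vec ℤ n → Bool
eqV [] [] = true
eqV (a ∷ u) (b ∷ v) = eqZ a b ∧ eqV u v

_==_ : SP → SP → Bool
u == v = eqV u v

-- w(i) for i = 1..4 (given as ℕ index i-1)
at : SP → ℕ → ℤ
at (a ∷ _ ∷ _ ∷ _ ∷ []) 0 = a
at (_ ∷ b ∷ _ ∷ _ ∷ []) 1 = b
at (_ ∷ _ ∷ c ∷ _ ∷ []) 2 = c
at (_ ∷ _ ∷ _ ∷ d ∷ []) 3 = d
at _ n = + suc n

act : SP → ℤ → ℤ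
act w (+ zero)   = + zero
act w (+ suc n)  = at w n
act w -[1+ n ]   = ℤ.- at w n

_∙_ : SP → SP → SP
u ∙ v = Vec.map (act u) v

e : SP
e = + 1 ∷ + 2 ∷ + 3 ∷ + 4 ∷ []

invAt : SP → ℤ → ℤ
invAt w j = go 0 4
  where
  go : ℕ → ℕ → ℤ
  go i zero = j
  go i (suc k) =
    if eqZ (at w i) j then + suc i
    else if eqZ (at w i) (ℤ.- j) then -[1+ i ]
    else go (suc i) k

inv : SP → SP
inv w = Vec.map (invAt w) e

data Gen : Set where
  s₁ s₂ s₃ s₄ : Gen

gens : List Gen
gens = s₁ ∷ s₂ ∷ s₃ ∷ s₄ ∷ []

-- s₁ = (1,-2)(-1,2), s₂ = (1,2)(-1,-2), s₃ = (2,3)(-2,-3), s₄ = (3,4)(-3,-4)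
gen : Gen → SP
gen s₁ = -[1+ 1 ] ∷ -[1+ 0 ] ∷ + 3 ∷ + 4 ∷ []
gen s₂ = + 2 ∷ + 1 ∷ + 3 ∷ + 4 ∷ []
gen s₃ = + 1 ∷ + 3 ∷ + 2 ∷ + 4 ∷ []
gen s₄ = + 1 ∷ + 2 ∷ + 4 ∷ + 3 ∷ []

elem : SP → List SP → Bool
elem x []       = false
elem x (y ∷ ys) = (x == y) ∨ elem x ys

dedup : List SP → List SP
dedup []       = []
dedup (x ∷ xs) = if elem x xs then dedup xs else x ∷ dedup xs

filterB : {A : Set} → (A → Bool) → List A → List A
filterB p []       = []
filterB p (x ∷ xs) = if p x then x ∷ filterB p xs else filterB p xs

-- The group W(D₄): all signed permutations of {±1,…,±4} with an even
-- number of sign changes (as in the stated realization).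

insertAll : ℤ → List ℤ → List (List ℤ)
insertAll a []       = (a ∷ []) ∷ []
insertAll a (b ∷ bs) = (a ∷ b ∷ bs) ∷ map (b ∷_) (insertAll a bs)

perms : List ℤ → List (List ℤ)
perms []       = [] ∷ []
perms (a ∷ as) = concatMap (insertAll a) (perms as)

evenSigns : List (Vec Bool 4)
evenSigns = filterB (λ v → evenB (count v)) (concatMap (λ a → concatMap (λ b →
              concatMap (λ c → map (λ d → a ∷ b ∷ c ∷ d ∷ []) bools) bools) bools) bools)
  where
  bools = false ∷ true ∷ []
  count : ∀ {n} → Vec Bool n → ℕ
  count []             = 0
  count (true  ∷ v)    = suc (count v)
  count (false ∷ v)    = count v
  evenB : ℕ → Bool
  evenB n = (n ℕ.% 2) ≡ᵇ 0

applySigns : Vec Bool 4 → List ℤ → SP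
applySigns (a ∷ b ∷ c ∷ d ∷ []) (x ∷ y ∷ z ∷ t ∷ []) = sg a x ∷ sg b y ∷ sg c z ∷ sg d t ∷ []
  where sg : Bool → ℤ → ℤ
        sg true  u = ℤ.- u
        sg false u = u
applySigns _ _ = e

Welems : List SP
Welems = concatMap (λ p → map (λ σ → applySigns σ p) evenSigns)
                   (perms (+ 1 ∷ + 2 ∷ + 3 ∷ + 4 ∷ []))

inW : SP → Bool
inW x = elem x Welems

-- Coxeter length of w ∈ W(D₄) (minimal length of an expression in
-- s₁,…,s₄), computed by the standard combinatorial formula for type D
-- (Björner–Brenti, Combinatorics of Coxeter Groups, Prop. 8.2.1):
--   ℓ(w) = #{i<j : w(i) > w(j)} + #{i<j : w(i) + w(j) < 0}.
len : SP → ℕ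
len w = pairs (Vec.toList w)
  where
  b2n : Bool → ℕ
  b2n true  = 1
  b2n false = 0
  cnt : ℤ → List ℤ → ℕ
  cnt a []       = 0
  cnt a (b ∷ bs) = b2n (ltZ b a) ℕ.+ b2n (ltZ (a ℤ.+ b) (+ 0)) ℕ.+ cnt a bs
  pairs : List ℤ → ℕ
  pairs []       = 0
  pairs (a ∷ as) = cnt a as ℕ.+ pairs as

leftDesc : Gen → SP → Bool
leftDesc s w = len (gen s ∙ w) <ᵇ len w

rightDesc : Gen → SP → Bool
rightDesc s w = len (w ∙ gen s) <ᵇ len w

-- Reflections T = { w s w⁻¹ : w ∈ W, s ∈ S }.  For W(D₄) these are the
-- twelve elements (i,j)(-i,-j) and (i,-j)(-i,j), 1 ≤ i < j ≤ 4
-- (Björner–Brenti §8.2); we list them explicitly.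
transp : ℕ → ℕ → Bool → SP
transp i j neg = Vec.map f e
  where
  f : ℤ → ℤ
  f (+ k) = if k ≡ᵇ i then (if neg then -[1+ j ∸ 1 ] else + j)
            else if k ≡ᵇ j then (if neg then -[1+ i ∸ 1 ] else + i)
            else + k
  f z = z

reflections : List SP
reflections = concatMap (λ ij → transp (proj₁ ij) (proj₂ ij) false ∷ transp (proj₁ ij) (proj₂ ij) true ∷ [])
  ((1 , 2) ∷ (1 , 3) ∷ (1 , 4) ∷ (2 , 3) ∷ (2 , 4) ∷ (3 , 4) ∷ [])

-- Bruhat order: x ≤ y iff there is a chain x = x₀ → x₁ → … → xₖ = y with
-- x_{i} = x_{i+1} t, t ∈ T, ℓ(x_i) < ℓ(x_{i+1}).  below y lists all such
-- x, computed by downward breadth-first search from y.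
down : SP → List SP
down x = filterB (λ z → len z <ᵇ len x) (map (λ t → x ∙ t) reflections)

belowF : ℕ → List SP → List SP → List SP
belowF zero    acc cur = cur ++ acc
belowF (suc n) acc cur = belowF n (cur ++ acc)
  (dedup (filterB (λ z → not (elem z acc')) (concatMap down cur)))
  where acc' = cur ++ acc

-- Bruhat interval below y (ℓ(y)+1 rounds of search suffice, since each
-- step lowers the length)
below : SP → List SP
below y = belowF (suc (len y)) [] (y ∷ [])

bruhatLt : SP → SP → Bool
bruhatLt x y = elem x (below y) ∧ not (x == y)

-- Kazhdan–Lusztig polynomials (coefficient lists in q, lowest degree first)

Poly : Set
Poly = List ℤ

_⊕_ : Poly → Poly → Poly
[]       ⊕ q        = q
p        ⊕ []       = p
(a ∷ p)  ⊕ (b ∷ q)  = (a ℤ.+ b) ∷ (p ⊕ q)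

scale : ℤ → Poly → Poly
scale c = map (c ℤ.*_)

shift : ℕ → Poly → Poly
shift zero    p = p
shift (suc k) p = + 0 ∷ shift k p

coeff : Poly → ℕ → ℤ
coeff []      _       = + 0
coeff (a ∷ p) zero    = a
coeff (a ∷ p) (suc k) = coeff p k

half : ℕ → ℕ
half n = n ℕ./ 2

odd : ℕ → Bool
odd n = (n ℕ.% 2) ≡ᵇ 1

firstLeftDesc : SP → Gen
firstLeftDesc y = go gens
  where
  go : List Gen → Gen
  go []       = s₁
  go (s ∷ ss) = if leftDesc s y then s else go ss

-- The Kazhdan–Lusztig recursion (KL 1979, (2.2.c)): for y ≠ e pick s with
-- sy < y, v = sy, c = 1 if sx < x else 0:
--  P_{x,y} = q^{1-c} P_{sx,v} + q^c P_{x,v}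
--            - Σ_{z < v, sz < z} μ(z,v) q^{(ℓ(y)-ℓ(z))/2} P_{x,z},
-- P_{x,e} = δ_{x,e}.  The ℕ argument is fuel (structural recursion),
-- and ℓ(y) fuel is always sufficient.
mutual
  KLP' : ℕ → SP → SP → Poly
  KLP' fuel x y =
    if y == e then (if x == e then + 1 ∷ [] else []) else step fuel x y

  step : ℕ → SP → SP → Poly
  step zero    x y = []
  step (suc n) x y =
    (shift (if c then 0 else 1) (KLP' n (gen s ∙ x) v)
      ⊕ shift (if c then 1 else 0) (KLP' n x v))
      ⊕ scale (ℤ.- + 1) (foldr _⊕_ []
          (map (λ z → scale (mu' n z v) (shift (half (len y ∸ len z)) (KLP' n x z)))
               (filterB (λ z → not (z == v) ∧ leftDesc s z) (below v))))
    where
    s = firstLeftDesc y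
    v = gen s ∙ y
    c = leftDesc s x

  mu' : ℕ → SP → SP → ℤ
  mu' n z v = if odd (len v ∸ len z)
              then coeff (KLP' n z v) (half (len v ∸ len z ∸ 1)) else + 0

KLP : SP → SP → Poly
KLP x y = KLP' (len y) x y

μ : SP → SP → ℤ
μ x y = if bruhatLt x y ∧ odd (len y ∸ len x)
        then coeff (KLP x y) (half (len y ∸ len x ∸ 1)) else + 0

Edge : SP → SP → Set
Edge x y = (inW x ≡ true) × (inW y ≡ true) × ((μ x y ≢ + 0) Data.Sum.⊎ (μ y x ≢ + 0))
  where import Data.Sum

LNotSub : SP → SP → Set
LNotSub x y = Σ Gen λ s → (leftDesc s x ≡ true) × (leftDesc s y ≡ false)

RNotSub : SP → SP → Set
RNotSub x y = Σ Gen λ s → (rightDesc s x ≡ true) × (rightDesc s y ≡ false)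

-- Kazhdan–Lusztig preorders (KL 1979): ≤_L is the preorder generated by
-- x ≤_L y when x — y and L(x) ⊄ L(y); ≤_R likewise with R; ≤_LR is the
-- preorder generated by ≤_L and ≤_R.

data _≤LR_ : SP → SP → Set where
  ≤LR-refl  : ∀ {x} → x ≤LR x
  ≤LR-stepL : ∀ {x y z} → Edge x y → LNotSub x y → y ≤LR z → x ≤LR z
  ≤LR-stepR : ∀ {x y z} → Edge x y → RNotSub x y → y ≤LR z → x ≤LR z

_∼LR_ : SP → SP → Set
x ∼LR y = (x ≤LR y) × (y ≤LR x)

w₄ : SP
w₄ = + 1 ∷ -[1+ 3 ] ∷ + 3 ∷ -[1+ 1 ] ∷ []

{-# OPTIONS --safe #-}
-- In the W-graph of W(D₄) the elements w₄ and s₁s₂s₄ lie on a closed walk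
--   w₄ — x₁ — x₂ — x₃ — s₁s₂s₄ — x₁ — x₂ — x₃′ — w₄
-- of μ-edges in which every step leaves an element for one whose left
-- descent set misses some left descent of the former. Hence each of the two
-- lies below the other already in the left preorder, a fortiori in ≤LR.
module Submission where

open import Data.Bool using (true)
open import Data.Integer using (ℤ; +_; -[1+_])
open import Data.Product using (_,_)
open import Data.Sum using (inj₁; inj₂)
open import Data.Vec using (_∷_; [])
open import Relation.Binary.PropositionalEquality using (_≡_; _≢_; refl)

open import Defs

≤LR-trans : ∀ {x y z} → x ≤LR y → y ≤LR z → x ≤LR z
≤LR-trans ≤LR-refl             y≤z = y≤z
≤LR-trans (≤LR-stepL e d x≤y) y≤z = ≤LR-stepL e d (≤LR-trans x≤y y≤z)
≤LR-trans (≤LR-stepR e d x≤y) y≤z = ≤LR-stepR e d (≤LR-trans x≤y y≤z)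

≡+1⇒≢+0 : ∀ {i : ℤ} → i ≡ + 1 → i ≢ + 0
≡+1⇒≢+0 refl ()

-- Conclusions are stated in the data type _≤LR_, never in Edge: Edge unfolds
-- to a Σ-type, so matching it against concrete elements makes the unifier
-- evaluate inW and μ.
μ≡1⇒≤LR : ∀ {x y} → inW x ≡ true → inW y ≡ true →
          μ x y ≡ + 1 → LNotSub x y → x ≤LR y
μ≡1⇒≤LR {y = y} x∈W y∈W μ≡1 L⊈ =
  ≤LR-stepL {y = y} (x∈W , y∈W , inj₁ (≡+1⇒≢+0 μ≡1)) L⊈ ≤LR-refl

μ˘≡1⇒≤LR : ∀ {x y} → inW x ≡ true → inW y ≡ true →
           μ y x ≡ + 1 → LNotSub x y → x ≤LR y
μ˘≡1⇒≤LR {y = y} x∈W y∈W μ≡1 L⊈ =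
  ≤LR-stepL {y = y} (x∈W , y∈W , inj₂ (≡+1⇒≢+0 μ≡1)) L⊈ ≤LR-refl

s₁s₂s₄ x₁ x₂ x₃ x₃′ : SP
s₁s₂s₄ = gen s₁ ∙ (gen s₂ ∙ gen s₄)
x₁     = -[1+ 1 ] ∷ -[1+ 3 ] ∷ + 3 ∷ + 1 ∷ []
x₂     = -[1+ 1 ] ∷ -[1+ 2 ] ∷ + 4 ∷ + 1 ∷ []
x₃     = -[1+ 0 ] ∷ -[1+ 2 ] ∷ + 4 ∷ + 2 ∷ []
x₃′    = + 1 ∷ -[1+ 3 ] ∷ + 2 ∷ -[1+ 2 ] ∷ []

μ-x₁-w₄ : μ x₁ w₄ ≡ + 1
μ-x₁-w₄ = refl

μ-x₂-x₁ : μ x₂ x₁ ≡ + 1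
μ-x₂-x₁ = refl

μ-x₃-x₂ : μ x₃ x₂ ≡ + 1
μ-x₃-x₂ = refl

μ-s₁s₂s₄-x₃ : μ s₁s₂s₄ x₃ ≡ + 1
μ-s₁s₂s₄-x₃ = refl

μ-s₁s₂s₄-x₁ : μ s₁s₂s₄ x₁ ≡ + 1
μ-s₁s₂s₄-x₁ = refl

μ-x₂-x₃′ : μ x₂ x₃′ ≡ + 1
μ-x₂-x₃′ = refl

μ-w₄-x₃′ : μ w₄ x₃′ ≡ + 1
μ-w₄-x₃′ = refl

w₄≤x₁ : w₄ ≤LR x₁
w₄≤x₁ = μ˘≡1⇒≤LR refl refl μ-x₁-w₄ (s₁ , refl , refl)

x₁≤x₂ : x₁ ≤LR x₂
x₁≤x₂ = μ˘≡1⇒≤LR refl refl μ-x₂-x₁ (s₄ , refl , refl)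

x₂≤x₃ : x₂ ≤LR x₃
x₂≤x₃ = μ˘≡1⇒≤LR refl refl μ-x₃-x₂ (s₂ , refl , refl)

x₃≤s₁s₂s₄ : x₃ ≤LR s₁s₂s₄
x₃≤s₁s₂s₄ = μ˘≡1⇒≤LR refl refl μ-s₁s₂s₄-x₃ (s₃ , refl , refl)

s₁s₂s₄≤x₁ : s₁s₂s₄ ≤LR x₁
s₁s₂s₄≤x₁ = μ≡1⇒≤LR refl refl μ-s₁s₂s₄-x₁ (s₁ , refl , refl)

x₂≤x₃′ : x₂ ≤LR x₃′
x₂≤x₃′ = μ≡1⇒≤LR refl refl μ-x₂-x₃′ (s₂ , refl , refl)

x₃′≤w₄ : x₃′ ≤LR w₄
x₃′≤w₄ = μ˘≡1⇒≤LR refl refl μ-w₄-x₃′ (s₃ , refl , refl)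

proposition4p16 : w₄ ∼LR (gen s₁ ∙ (gen s₂ ∙ gen s₄))
proposition4p16 =
  ≤LR-trans w₄≤x₁ (≤LR-trans x₁≤x₂ (≤LR-trans x₂≤x₃ x₃≤s₁s₂s₄)) ,
  ≤LR-trans s₁s₂s₄≤x₁ (≤LR-trans x₁≤x₂ (≤LR-trans x₂≤x₃′ x₃′≤w₄))
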